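{- Let $A\subseteq\{0,1\}^k$ be a predicate with no forced $1$-bit. If $\mathrm{Pol}(\mathrm{fPCSP}(A,\mathrm{OR}))$ contains infinitely many functions from $\{\mathrm{id}(\neg\mathrm{Maj}_\ell):\ell\text{ odd}\}$, then it also contains infinitely many functions from $\{\neg\mathrm{Maj}_\ell:\ell\text{ odd}\}$.
   Context: A predicate is a set $\emptyset\ne A\subsetneq\{0,1\}^k$; $\mathrm{OR}=\{0,1\}^k\setminus\{0^k\}$. $A$ has a forced $1$-bit if there is $i\in[k]$ with $a_i=1$ for all $a\in A$. A function $f:\{0,1\}^\ell\to\{0,1\}$ is a polymorphism of $\mathrm{PCSP}(A,B)$ if for every $k\times\ell$ matrix $M$ whose columns lie in $A$, the vector of values of $f$ on the rows of $M$ lies in $B$; $\mathrm{Pol}(\mathrm{fPCSP}(A,B))$ is the set of such polymorphisms that are folded ($f(\neg x)=\neg f(x)$). For odd $\ell$, $\mathrm{Maj}_\ell(x)=[w(x)\ge\ell/2]$ with $w(x)$ the number of ones. For $f:\{0,1\}^\ell\to\{0,1\}$, $\mathrm{id}f$ equals $0$ at $0^\ell$, $1$ at $1^\ell$, and $f(x)$ otherwise. -}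

module Defs where

open import Data.Bool using (Bool; true; false; not; if_then_else_)
open import Data.Bool.Properties using () renaming (_≟_ to _≟ᵇ_)
open import Data.Nat using (ℕ; zero; suc; _+_; _*_; _≤_; _≤ᵇ_)
open import Data.Fin using (Fin)
open import Data.Vec using (Vec; []; _∷_; map; lookup; replicate)
open import Data.Vec.Properties using (≡-dec)
open import Data.Product using (Σ; ∃; ∃-syntax; _×_)
open import Relation.Nullary using (¬_; yes; no)
open import Relation.Binary.PropositionalEquality using (_≡_; _≢_)

-- Boolean vectors {0,1}^k, with 0 = false, 1 = true.
Bits : ℕ → Set
Bits k = Vec Bool k

Subset : ℕ → Set₁
Subset k = Bits k → Set

IsPredicate : {k : ℕ} → Subset k → Set
IsPredicate {k} A = (∃[ a ] A a) × (∃[ b ] ¬ A b)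

OR : (k : ℕ) → Subset k
OR k x = x ≢ replicate k false

HasForced1 : {k : ℕ} → Subset k → Set
HasForced1 {k} A = ∃[ i ] (∀ (a : Bits k) → A a → lookup a i ≡ true)

-- Polymorphism of PCSP(A,B): for every k × ℓ matrix M (k rows of length ℓ)
-- whose columns lie in A, the vector of values of f on the rows lies in B.
column : {k ℓ : ℕ} → Vec (Bits ℓ) k → Fin ℓ → Bits k
column M j = map (λ row → lookup row j) M

IsPolymorphism : {k ℓ : ℕ} → Subset k → Subset k → (Bits ℓ → Bool) → Set
IsPolymorphism {k} {ℓ} A B f =
  ∀ (M : Vec (Bits ℓ) k) → (∀ (j : Fin ℓ) → A (column M j)) → B (map f M)

Folded : {ℓ : ℕ} → (Bits ℓ → Bool) → Set
Folded f = ∀ x → f (map not x) ≡ not (f x)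

InPolF : {k ℓ : ℕ} → Subset k → Subset k → (Bits ℓ → Bool) → Set
InPolF A B f = IsPolymorphism A B f × Folded f

weight : {ℓ : ℕ} → Bits ℓ → ℕ
weight [] = 0
weight (true ∷ xs) = suc (weight xs)
weight (false ∷ xs) = weight xs

-- Maj_ℓ(x) = [w(x) ≥ ℓ/2], i.e. [ℓ ≤ 2 w(x)]
Maj : (ℓ : ℕ) → Bits ℓ → Bool
Maj ℓ x = ℓ ≤ᵇ (2 * weight x)

notMaj : (ℓ : ℕ) → Bits ℓ → Bool
notMaj ℓ x = not (Maj ℓ x)

idf : {ℓ : ℕ} → (Bits ℓ → Bool) → Bits ℓ → Bool
idf {ℓ} f x with ≡-dec _≟ᵇ_ x (replicate ℓ false)
... | yes _ = false
... | no _ with ≡-dec _≟ᵇ_ x (replicate ℓ true)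
...   | yes _ = true
...   | no _ = f x

-- Odd ℓ is written ℓ = 2m+1; "infinitely many" ℓ means unboundedly many.
InfinitelyManyOdd : (ℕ → Set) → Set
InfinitelyManyOdd P = ∀ (N : ℕ) → ∃[ m ] (N ≤ m × P (suc (2 * m)))

{-# OPTIONS --safe #-}
module Submission where

open import Defs
open import Data.Nat using (ℕ; suc; zero; _+_; _*_; _∸_; _≤_; _<_; NonZero; _≤ᵇ_)
open import Relation.Nullary using (¬_; yes; no)
open import Function using (_∘_; _⇔_; Equivalence; mk⇔)
open import Data.Bool using (Bool; true; false; not)
open import Data.Bool.Properties using (T-≡; ¬-not; not-injective) renaming (_≟_ to _≟ᵇ_)
open import Data.Nat.Properties
open import Data.Nat.Tactic.RingSolver using (solve-∀)
open import Data.Nat.DivMod using (_/_; _%_; m≡m%n+[m/n]*n; m%n<n; m*n/n≡m; /-monoˡ-≤)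
open import Data.Fin using (Fin; zero; suc; _↑ˡ_)
open import Data.Fin.Properties using (∀-cons)
open import Data.Vec using (Vec; []; _∷_; map; lookup; replicate; zipWith; tabulate; _++_; concat)
open import Data.Vec.Properties
  using (≡-dec; lookup-replicate; lookup-zipWith; lookup-map; lookup-++ˡ; lookup∘tabulate;
         tabulate∘lookup; tabulate-cong; tabulate-∘; map-++; map-concat; map-replicate)
open import Data.Vec.Relation.Unary.All using (All; []; _∷_)
open import Data.Vec.Relation.Unary.All.Properties using (++⁺; concat⁺; lookup⁺; lookup⁻)
open import Data.Product using (∃-syntax; Σ-syntax; _×_; _,_; proj₁; proj₂)
open import Relation.Nullary.Negation using (contradiction)
open import Relation.Binary.PropositionalEquality

-- In fact ¬Maj_ℓ is a (folded) polymorphism for every odd ℓ = 2N+1, as soon as id(¬Maj_L) is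
-- one for a single large L.  Let M have columns in A and all rows of weight > N, and write
-- L = (k + s) + q·ℓ with k + s ≤ q.  Consider the L columns consisting of, for each row r,
-- a column of A that is 0 in row r (one exists since no bit of A is forced), s further columns
-- of A, and q copies of the columns of M.  Every row of this matrix contains a 0 and has weight
-- at least q(N+1), so twice its weight is at least qℓ + q ≥ L; hence id(¬Maj_L) vanishes on
-- every row, which contradicts OR.  Since the goal is a negation, choosing the zero columns
-- only needs to happen under a double negation.

¬¬-∀-Fin : ∀ {n} {P : Fin n → Set} → (∀ i → ¬ ¬ P i) → ¬ ¬ (∀ i → P i)
¬¬-∀-Fin {zero}  ¬¬P ¬∀P = ¬∀P (λ ())
¬¬-∀-Fin {suc n} ¬¬P ¬∀P =
  ¬¬P zero (λ P₀ → ¬¬-∀-Fin (¬¬P ∘ suc) (λ P₊ → ¬∀P (∀-cons P₀ P₊)))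

ZeroAt : ∀ {k} → Subset k → Fin k → Set
ZeroAt A i = ∃[ a ] (A a × lookup a i ≡ false)

¬HasForced1⇒¬¬ZeroAt : ∀ {k} {A : Subset k} → ¬ HasForced1 A → ∀ i → ¬ ¬ ZeroAt A i
¬HasForced1⇒¬¬ZeroAt {A = A} ¬forced i ¬zero = ¬forced (i , forced)
  where
  forced : ∀ a → A a → lookup a i ≡ true
  forced a a∈A = ¬-not (λ aᵢ≡false → ¬zero (a , a∈A , aᵢ≡false))

fromColumns : ∀ {k L} → Vec (Bits k) L → Vec (Bits L) k
fromColumns []       = replicate _ []
fromColumns (c ∷ cs) = zipWith _∷_ c (fromColumns cs)

lookup-fromColumns : ∀ {k L} (C : Vec (Bits k) L) r →
                     lookup (fromColumns C) r ≡ map (λ c → lookup c r) C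
lookup-fromColumns []       r = lookup-replicate r []
lookup-fromColumns (c ∷ cs) r =
  trans (lookup-zipWith _∷_ r c _) (cong (lookup c r ∷_) (lookup-fromColumns cs r))

column-zero-zipWith-∷ : ∀ {k L} (c : Bits k) (X : Vec (Bits L) k) →
                       column (zipWith _∷_ c X) zero ≡ c
column-zero-zipWith-∷ []      []      = refl
column-zero-zipWith-∷ (b ∷ c) (_ ∷ X) = cong (b ∷_) (column-zero-zipWith-∷ c X)

column-suc-zipWith-∷ : ∀ {k L} (c : Bits k) (X : Vec (Bits L) k) j →
                       column (zipWith _∷_ c X) (suc j) ≡ column X j
column-suc-zipWith-∷ []      []      j = refl
column-suc-zipWith-∷ (b ∷ c) (x ∷ X) j = cong (lookup x j ∷_) (column-suc-zipWith-∷ c X j)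

column-fromColumns : ∀ {k L} (C : Vec (Bits k) L) j → column (fromColumns C) j ≡ lookup C j
column-fromColumns (c ∷ cs) zero    = column-zero-zipWith-∷ c (fromColumns cs)
column-fromColumns (c ∷ cs) (suc j) =
  trans (column-suc-zipWith-∷ c (fromColumns cs) j) (column-fromColumns cs j)

columns : ∀ {k ℓ} → Vec (Bits ℓ) k → Vec (Bits k) ℓ
columns M = tabulate (column M)

map-lookup-columns : ∀ {k ℓ} (M : Vec (Bits ℓ) k) r →
                     map (λ c → lookup c r) (columns M) ≡ lookup M r
map-lookup-columns M r = begin
  map (λ c → lookup c r) (tabulate (column M))
    ≡⟨ tabulate-∘ (λ c → lookup c r) (column M) ⟨
  tabulate (λ j → lookup (column M j) r)
    ≡⟨ tabulate-cong (λ j → lookup-map r (λ row → lookup row j) M) ⟩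
  tabulate (lookup (lookup M r))
    ≡⟨ tabulate∘lookup (lookup M r) ⟩
  lookup M r ∎
  where open ≡-Reasoning

map-≡-replicate⁺ : ∀ {A B : Set} {n} (f : A → B) {b} (xs : Vec A n) →
                   (∀ i → f (lookup xs i) ≡ b) → map f xs ≡ replicate n b
map-≡-replicate⁺ f []       _  = refl
map-≡-replicate⁺ f (x ∷ xs) fb = cong₂ _∷_ (fb zero) (map-≡-replicate⁺ f xs (fb ∘ suc))

map-≡-replicate⁻ : ∀ {A B : Set} {n} (f : A → B) {b} (xs : Vec A n) →
                   map f xs ≡ replicate n b → ∀ i → f (lookup xs i) ≡ b
map-≡-replicate⁻ f {b} xs e i = begin
  f (lookup xs i)              ≡⟨ lookup-map i f xs ⟨
  lookup (map f xs) i          ≡⟨ cong (λ v → lookup v i) e ⟩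
  lookup (replicate _ b) i     ≡⟨ lookup-replicate i b ⟩
  b                            ∎
  where open ≡-Reasoning

All-replicate : ∀ {A : Set} {P : A → Set} {x} n → P x → All P (replicate n x)
All-replicate zero    _  = []
All-replicate (suc n) px = px ∷ All-replicate n px

weight-++ : ∀ {m n} (xs : Bits m) (ys : Bits n) → weight (xs ++ ys) ≡ weight xs + weight ys
weight-++ []           ys = refl
weight-++ (true ∷ xs)  ys = cong suc (weight-++ xs ys)
weight-++ (false ∷ xs) ys = weight-++ xs ys

weight-concat-replicate : ∀ {n} q (xs : Bits n) →
                          weight (concat (replicate q xs)) ≡ q * weight xs
weight-concat-replicate zero    xs = refl
weight-concat-replicate (suc q) xs =
  trans (weight-++ xs _) (cong (weight xs +_) (weight-concat-replicate q xs))

weight-map-not : ∀ {n} (x : Bits n) → weight (map not x) + weight x ≡ n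
weight-map-not []          = refl
weight-map-not (true ∷ x)  = trans (+-suc _ _) (cong suc (weight-map-not x))
weight-map-not (false ∷ x) = cong suc (weight-map-not x)

idf-false : ∀ {ℓ} (f : Bits ℓ → Bool) {x : Bits ℓ} (i : Fin ℓ) →
            lookup x i ≡ false → f x ≡ false → idf f x ≡ false
idf-false {ℓ} f {x} i xᵢ≡false fx≡false with ≡-dec _≟ᵇ_ x (replicate ℓ false)
... | yes _ = refl
... | no _ with ≡-dec _≟ᵇ_ x (replicate ℓ true)
...   | yes refl = contradiction (trans (sym (lookup-replicate i true)) xᵢ≡false) λ ()
...   | no _    = fx≡false

Maj-true : ∀ {ℓ} {x : Bits ℓ} → ℓ ≤ 2 * weight x → Maj ℓ x ≡ true
Maj-true {ℓ} {x} = Equivalence.to (T-≡ {ℓ ≤ᵇ 2 * weight x}) ∘ ≤⇒≤ᵇ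

Maj-odd-true⇔ : ∀ m (x : Bits (suc (2 * m))) → Maj (suc (2 * m)) x ≡ true ⇔ m < weight x
Maj-odd-true⇔ m x = mk⇔
  (λ maj → *-cancelˡ-< 2 m (weight x) (≤ᵇ⇒≤ _ _ (Equivalence.from T-≡ maj)))
  (λ m<w → Maj-true {x = x} (*-monoʳ-< 2 m<w))

<-complement-odd : ∀ {m w w′} → w′ + w ≡ suc (2 * m) → m < w′ ⇔ w ≤ m
<-complement-odd {m} {w} {w′} w′+w≡ = mk⇔
  (λ m<w′ → +-cancelˡ-≤ (suc m) w m (begin
    suc m + w    ≤⟨ +-monoˡ-≤ w m<w′ ⟩
    w′ + w       ≡⟨ w′+w≡ ⟩
    suc (2 * m)  ≡⟨ 2m+1≡ ⟩
    suc m + m    ∎))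
  (λ w≤m → +-cancelʳ-≤ m (suc m) w′ (begin
    suc m + m    ≡⟨ 2m+1≡ ⟨
    suc (2 * m)  ≡⟨ w′+w≡ ⟨
    w′ + w       ≤⟨ +-monoʳ-≤ w′ w≤m ⟩
    w′ + m       ∎))
  where
  open ≤-Reasoning
  2m+1≡ : suc (2 * m) ≡ suc m + m
  2m+1≡ = cong (λ t → suc (m + t)) (+-identityʳ m)

⇔≢⇒≡not : ∀ {a b} → (a ≡ true ⇔ b ≢ true) → a ≡ not b
⇔≢⇒≡not {b = true}  a⇔b≢ = ¬-not (λ a≡true → Equivalence.to a⇔b≢ a≡true refl)
⇔≢⇒≡not {b = false} a⇔b≢ = Equivalence.from a⇔b≢ (λ ())

Maj-odd-map-not : ∀ m (x : Bits (suc (2 * m))) →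
                  Maj (suc (2 * m)) (map not x) ≡ not (Maj (suc (2 * m)) x)
Maj-odd-map-not m x = ⇔≢⇒≡not (mk⇔
  (λ maj¬x majx → ≤⇒≯ (to complement (to (Maj-odd-true⇔ m (map not x)) maj¬x))
                            (to (Maj-odd-true⇔ m x) majx))
  (λ ¬majx → from (Maj-odd-true⇔ m (map not x))
                   (from complement (≮⇒≥ (¬majx ∘ from (Maj-odd-true⇔ m x))))))
  where
  open Equivalence
  complement : m < weight (map not x) ⇔ weight x ≤ m
  complement = <-complement-odd (weight-map-not x)

notMaj-odd-folded : ∀ m → Folded (notMaj (suc (2 * m)))
notMaj-odd-folded m x = cong not (Maj-odd-map-not m x)

padded-division : ∀ k ℓ {L} .{{_ : NonZero ℓ}} → k + (k + ℓ) * ℓ ≤ L →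
                  ∃[ q ] ∃[ s ] (L ≡ (k + s) + q * ℓ × k + s ≤ q)
padded-division k ℓ {L} bound = n / ℓ , n % ℓ , L≡ , room
  where
  n : ℕ
  n = L ∸ k
  k+n≡L : k + n ≡ L
  k+n≡L = m+[n∸m]≡n (≤-trans (m≤m+n k _) bound)
  L≡ : L ≡ (k + n % ℓ) + n / ℓ * ℓ
  L≡ = begin
    L                        ≡⟨ k+n≡L ⟨
    k + n                    ≡⟨ cong (k +_) (m≡m%n+[m/n]*n n ℓ) ⟩
    k + (n % ℓ + n / ℓ * ℓ)  ≡⟨ +-assoc k (n % ℓ) (n / ℓ * ℓ) ⟨
    (k + n % ℓ) + n / ℓ * ℓ  ∎
    where open ≡-Reasoning
  room : k + n % ℓ ≤ n / ℓ
  room = begin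
    k + n % ℓ         ≤⟨ +-monoʳ-≤ k (<⇒≤ (m%n<n n ℓ)) ⟩
    k + ℓ             ≡⟨ m*n/n≡m (k + ℓ) ℓ ⟨
    (k + ℓ) * ℓ / ℓ   ≤⟨ /-monoˡ-≤ ℓ (+-cancelˡ-≤ k _ _ k+[k+ℓ]ℓ≤k+n) ⟩
    n / ℓ             ∎
    where
    open ≤-Reasoning
    k+[k+ℓ]ℓ≤k+n : k + (k + ℓ) * ℓ ≤ k + n
    k+[k+ℓ]ℓ≤k+n = subst (k + (k + ℓ) * ℓ ≤_) (sym k+n≡L) bound

RowsHaveZero : ∀ {k p} → Vec (Bits k) p → Set
RowsHaveZero {k} J = ∀ (r : Fin k) → ∃[ i ] lookup (lookup J i) r ≡ false

q+q*[1+2N]≡2*[q*[1+N]] : ∀ q N → q + q * suc (2 * N) ≡ 2 * (q * suc N)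
q+q*[1+2N]≡2*[q*[1+N]] = solve-∀

padding-kills-idf-notMaj :
  ∀ {k N p q} (J : Vec (Bits k) p) (M : Vec (Bits (suc (2 * N))) k) →
  p ≤ q → RowsHaveZero J → (∀ r → N < weight (lookup M r)) → ∀ r →
  idf (notMaj (p + q * suc (2 * N)))
      (lookup (fromColumns (J ++ concat (replicate q (columns M)))) r) ≡ false
padding-kills-idf-notMaj {k} {N} {p} {q} J M p≤q zeros majority r =
  subst (λ x → idf (notMaj L) x ≡ false) (sym (lookup-fromColumns C r))
        (idf-false (notMaj L) {row} (proj₁ (zeros r) ↑ˡ q * ℓ) row-zero
                   (cong not (Maj-true {x = row} row-majority)))
  where
  ℓ L : ℕ
  ℓ = suc (2 * N)
  L = p + q * ℓ
  copies : Vec (Bits k) (q * ℓ)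
  copies = concat (replicate q (columns M))
  C : Vec (Bits k) L
  C = J ++ copies
  at-r : Bits k → Bool
  at-r c = lookup c r
  row : Bits L
  row = map at-r C
  row-zero : lookup row (proj₁ (zeros r) ↑ˡ q * ℓ) ≡ false
  row-zero = begin
    lookup (map at-r C) (i ↑ˡ q * ℓ)  ≡⟨ lookup-map (i ↑ˡ q * ℓ) at-r C ⟩
    at-r (lookup C (i ↑ˡ q * ℓ))      ≡⟨ cong at-r (lookup-++ˡ J copies i) ⟩
    lookup (lookup J i) r             ≡⟨ proj₂ (zeros r) ⟩
    false                             ∎
    where
    open ≡-Reasoning
    i = proj₁ (zeros r)
  weight-copies : weight (map at-r copies) ≡ q * weight (lookup M r)
  weight-copies = begin
    weight (map at-r (concat (replicate q (columns M))))
      ≡⟨ cong weight (map-concat at-r (replicate q (columns M))) ⟩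
    weight (concat (map (map at-r) (replicate q (columns M))))
      ≡⟨ cong (weight ∘ concat) (map-replicate (map at-r) (columns M) q) ⟩
    weight (concat (replicate q (map at-r (columns M))))
      ≡⟨ weight-concat-replicate q _ ⟩
    q * weight (map at-r (columns M))
      ≡⟨ cong (λ v → q * weight v) (map-lookup-columns M r) ⟩
    q * weight (lookup M r) ∎
    where open ≡-Reasoning
  row-majority : L ≤ 2 * weight row
  row-majority = begin
    p + q * ℓ
      ≤⟨ +-monoˡ-≤ (q * ℓ) p≤q ⟩
    q + q * ℓ
      ≡⟨ q+q*[1+2N]≡2*[q*[1+N]] q N ⟩
    2 * (q * suc N)
      ≤⟨ *-monoʳ-≤ 2 (*-monoʳ-≤ q (majority r)) ⟩
    2 * (q * weight (lookup M r))
      ≡⟨ cong (2 *_) weight-copies ⟨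
    2 * weight (map at-r copies)
      ≤⟨ *-monoʳ-≤ 2 (m≤n+m _ (weight (map at-r J))) ⟩
    2 * (weight (map at-r J) + weight (map at-r copies))
      ≡⟨ cong (2 *_) (weight-++ (map at-r J) _) ⟨
    2 * weight (map at-r J ++ map at-r copies)
      ≡⟨ cong (λ v → 2 * weight v) (map-++ at-r J copies) ⟨
    2 * weight row ∎
    where open ≤-Reasoning

padding⇒notMaj-pol :
  ∀ {k N p q} {A : Subset k} (J : Vec (Bits k) p) → All A J → RowsHaveZero J → p ≤ q →
  IsPolymorphism A (OR k) (idf (notMaj (p + q * suc (2 * N)))) →
  IsPolymorphism A (OR k) (notMaj (suc (2 * N)))
padding⇒notMaj-pol {k} {N} {p} {q} {A} J J∈A zeros p≤q idf-pol M M∈A notMaj≡0 =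
  idf-pol (fromColumns C) C∈A
    (map-≡-replicate⁺ (idf (notMaj _)) (fromColumns C)
      (padding-kills-idf-notMaj J M p≤q zeros majority))
  where
  C : Vec (Bits k) (p + q * suc (2 * N))
  C = J ++ concat (replicate q (columns M))
  columns-M∈A : All A (columns M)
  columns-M∈A = lookup⁻ (λ j → subst A (sym (lookup∘tabulate (column M) j)) (M∈A j))
  C∈A : ∀ j → A (column (fromColumns C) j)
  C∈A j = subst A (sym (column-fromColumns C j))
                  (lookup⁺ (++⁺ J∈A (concat⁺ (All-replicate q columns-M∈A))) j)
  majority : ∀ r → N < weight (lookup M r)
  majority r = Equivalence.to (Maj-odd-true⇔ N (lookup M r))
                 (not-injective (map-≡-replicate⁻ (notMaj _) M notMaj≡0 r))

zero-padding : ∀ {k} {A : Subset k} → (∀ i → ZeroAt A i) → ∃[ a ] A a → ∀ s →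
               Σ[ J ∈ Vec (Bits k) (k + s) ] (All A J × RowsHaveZero J)
zero-padding {k} {A} zeros (a , a∈A) s = Z ++ replicate s a , Z++a∈A , Z++a-zeros
  where
  Z : Vec (Bits k) k
  Z = tabulate (proj₁ ∘ zeros)
  Z∈A : All A Z
  Z∈A = lookup⁻ (λ i → subst A (sym (lookup∘tabulate (proj₁ ∘ zeros) i))
                                 (proj₁ (proj₂ (zeros i))))
  Z++a∈A : All A (Z ++ replicate s a)
  Z++a∈A = ++⁺ Z∈A (All-replicate s a∈A)
  Z++a-zeros : RowsHaveZero (Z ++ replicate s a)
  Z++a-zeros r = r ↑ˡ s , (begin
    lookup (lookup (Z ++ replicate s a) (r ↑ˡ s)) r
      ≡⟨ cong (λ c → lookup c r) (lookup-++ˡ Z _ r) ⟩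
    lookup (lookup Z r) r
      ≡⟨ cong (λ c → lookup c r) (lookup∘tabulate (proj₁ ∘ zeros) r) ⟩
    lookup (proj₁ (zeros r)) r
      ≡⟨ proj₂ (proj₂ (zeros r)) ⟩
    false ∎)
    where open ≡-Reasoning

idf-notMaj-pol⇒notMaj-pol :
  ∀ {k} {A : Subset k} → ∃[ a ] A a → ¬ HasForced1 A → ∀ N L →
  k + (k + suc (2 * N)) * suc (2 * N) ≤ L →
  IsPolymorphism A (OR k) (idf (notMaj L)) → IsPolymorphism A (OR k) (notMaj (suc (2 * N)))
idf-notMaj-pol⇒notMaj-pol {k} a∈A ¬forced N L L-large idf-pol M M∈A notMaj≡0
  with padded-division k (suc (2 * N)) L-large
... | q , s , refl , room = ¬¬-∀-Fin (¬HasForced1⇒¬¬ZeroAt ¬forced) λ zeros →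
  let J , J∈A , J-zeros = zero-padding zeros a∈A s in
  padding⇒notMaj-pol {N = N} J J∈A J-zeros room idf-pol M M∈A notMaj≡0

lemma4p6 : {k : ℕ} (A : Subset k) → IsPredicate A → ¬ HasForced1 A
    → InfinitelyManyOdd (λ ℓ → InPolF A (OR k) (idf (notMaj ℓ)))
    → InfinitelyManyOdd (λ ℓ → InPolF A (OR k) (notMaj ℓ))
lemma4p6 {k} A (a∈A , _) ¬forced idf-pols N =
  let ℓ = suc (2 * N)
      m , bound≤m , (idf-pol , _) = idf-pols (k + (k + ℓ) * ℓ)
      bound≤L = ≤-trans bound≤m (m≤n⇒m≤1+n (m≤m+n m _))
  in N , ≤-refl , idf-notMaj-pol⇒notMaj-pol a∈A ¬forced N (suc (2 * m)) bound≤L idf-pol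
       , notMaj-odd-folded N
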